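{- Let $n\geq 5$. Among all trees with $n$ vertices, the path $P_{n}$ has the minimum value of $ZC_{1}^{*}$; that is, $ZC_{1}^{*}(T)\geq ZC_{1}^{*}(P_{n})$ for every tree $T$ on $n$ vertices.
   Context: For a vertex $v$ of a graph $G$, $d_v$ denotes its degree and $\tau_v$ denotes the number of vertices at distance exactly $2$ from $v$. The modified first Zagreb connection index is $ZC_{1}^{*}(G)=\sum_{v\in V(G)}d_{v}\tau_{v}$. $P_n$ denotes the path on $n$ vertices. -}

module Defs where

open import Data.Nat using (ℕ; zero; suc; _+_; _*_; _≤_; _≡ᵇ_)
open import Data.Fin using (Fin; toℕ)
open import Data.Bool using (Bool; true; false; if_then_else_; _∧_; _∨_; not)
open import Data.Bool.Properties using (∨-comm)
open import Data.List using (List; []; _∷_; _++_; [_]; length; map; allFin)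
open import Data.Nat.ListAction using (sum)
open import Data.Bool.ListAction using (any)
open import Data.List.Relation.Unary.Linked using (Linked)
open import Data.List.Relation.Unary.Unique.Propositional using (Unique)
open import Data.Product using (Σ; _×_; ∃)
open import Relation.Binary.PropositionalEquality using (_≡_; refl)
open import Relation.Nullary using (¬_)

record Graph (n : ℕ) : Set where
  field
    adj    : Fin n → Fin n → Bool
    sym    : ∀ i j → adj i j ≡ adj j i
    irrefl : ∀ i → adj i i ≡ false
open Graph public

module _ {n : ℕ} (G : Graph n) where

  Adj : Fin n → Fin n → Set
  Adj u v = adj G u v ≡ true

  data Walk : Fin n → Fin n → Set where
    here : ∀ {u} → Walk u u
    step : ∀ {u w v} → Adj u w → Walk w v → Walk u v

  Connected : Set
  Connected = ∀ u v → Walk u v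

  IsCycle : List (Fin n) → Set
  IsCycle [] = Data.Empty.⊥
    where import Data.Empty
  IsCycle (x ∷ ys) = (3 ≤ length (x ∷ ys)) × Unique (x ∷ ys) × Linked Adj ((x ∷ ys) ++ [ x ])

  Acyclic : Set
  Acyclic = ∀ xs → ¬ IsCycle xs

  IsTree : Set
  IsTree = Connected × Acyclic

count : ∀ {n} → (Fin n → Bool) → ℕ
count {n} p = sum (map (λ i → if p i then 1 else 0) (allFin n))

module _ {n : ℕ} (G : Graph n) where

  degree : Fin n → ℕ
  degree v = count (adj G v)

  _==_ : Fin n → Fin n → Bool
  i == j = Data.Nat._≡ᵇ_ (toℕ i) (toℕ j)
    where import Data.Nat

  commonNbr : Fin n → Fin n → Bool
  commonNbr u v = any (λ w → adj G u w ∧ adj G w v) (allFin n)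

  -- d(u,v) = 2 in a simple graph: u ≠ v, u,v not adjacent, and they have a common neighbour
  dist2 : Fin n → Fin n → Bool
  dist2 u v = not (u == v) ∧ not (adj G u v) ∧ commonNbr u v

  τ : Fin n → ℕ
  τ v = count (dist2 v)

  ZC1* : ℕ
  ZC1* = sum (map (λ v → degree v * τ v) (allFin n))

pathAdj : ∀ {n} → Fin n → Fin n → Bool
pathAdj i j = (suc (toℕ i) ≡ᵇ toℕ j) ∨ (suc (toℕ j) ≡ᵇ toℕ i)

pathAdj-sym : ∀ {n} (i j : Fin n) → pathAdj i j ≡ pathAdj j i
pathAdj-sym i j = ∨-comm (suc (toℕ i) ≡ᵇ toℕ j) (suc (toℕ j) ≡ᵇ toℕ i)

sucᵇ-irrefl : ∀ m → (suc m ≡ᵇ m) ≡ false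
sucᵇ-irrefl zero = refl
sucᵇ-irrefl (suc m) = sucᵇ-irrefl m

pathAdj-irrefl : ∀ {n} (i : Fin n) → pathAdj i i ≡ false
pathAdj-irrefl i rewrite sucᵇ-irrefl (toℕ i) = refl

P : (n : ℕ) → Graph n
P n = record { adj = pathAdj ; sym = pathAdj-sym ; irrefl = pathAdj-irrefl }

module Submission where

-- Both sides are compared with 4n - 10.
--
-- In an acyclic graph every vertex w at distance
-- two from v is reached through a unique neighbour u of v, so
-- τ_v ≥ Σ_{u ~ v} (d_u - 1) and ZC₁*(T) ≥ Σ_{v ~ u} d_v (d_u - 1), a sum over
-- ordered adjacent pairs.  A weight share(d) per vertex and incident edge is
-- paid for by this sum plus the degree sum D (share-edge), while a vertex of
-- degree d collects d · share d ≥ 6d - 6 (share-vertex); hence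
-- 6D ≤ ZC₁*(T) + D + 6n.  Connectivity gives D ≥ 2n - 2 (degreeSum-lower,
-- by growing balls around a root), and linear arithmetic yields 4n - 10.
--
-- On P_n each vertex has at most one neighbour and
-- at most one vertex at distance two on each side, with the missing ones near
-- the ends accounting for 10; so ZC₁*(P_n) ≤ 4n - 10 for n ≥ 4.

open import Defs hiding (sym)
open import Data.Nat
  using (ℕ; zero; suc; _+_; _*_; _∸_; _≤_; _<_; z≤n; s≤s; _≡ᵇ_; _≤′_; ≤′-refl; ≤′-step)
open import Data.Nat.Properties
open import Data.Nat.Tactic.RingSolver using (solve-∀)
open import Data.Fin as Fin using (Fin; toℕ)
import Data.Fin.Properties as Finₚ
open import Data.Bool using (Bool; true; false; if_then_else_; _∧_; _∨_; not)
open import Data.Bool.Properties using (T-≡; ¬-not; not-injective)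
open import Data.List using ([]; _∷_; map; allFin; tabulate)
open import Data.List.Properties using (map-tabulate)
import Data.Nat.ListAction as List
open import Data.Bool.ListAction using (any)
open import Data.List.Relation.Unary.Any using (satisfied)
open import Data.List.Relation.Unary.Any.Properties using (any⁺; any⁻)
open import Data.List.Membership.Propositional using (lose)
open import Data.List.Membership.Propositional.Properties using (∈-allFin)
open import Data.List.Relation.Unary.Linked using ([-]; _∷_)
open import Data.List.Relation.Unary.AllPairs using ([]; _∷_)
open import Data.List.Relation.Unary.All using ([]; _∷_)
open import Algebra.Properties.Semiring.Sum +-*-semiring
  using (sum-syntax; ∑-distrib-+; ∑-comm; sum-cong-≗; *-distribˡ-sum)
open import Data.Product using (_×_; ∃; _,_)
open import Data.Sum using (_⊎_; inj₁; inj₂)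
open import Data.Empty using (⊥; ⊥-elim)
open import Function using (_∘_; id; flip; Equivalence)
open import Relation.Binary.PropositionalEquality
open import Relation.Nullary using (yes; no)

sum-tabulate : ∀ n (f : Fin n → ℕ) → List.sum (tabulate f) ≡ ∑[ i < n ] f i
sum-tabulate zero    f = refl
sum-tabulate (suc n) f = cong (f Fin.zero +_) (sum-tabulate n (f ∘ Fin.suc))

sum-allFin : ∀ n (f : Fin n → ℕ) → List.sum (map f (allFin n)) ≡ ∑[ i < n ] f i
sum-allFin n f = trans (cong List.sum (map-tabulate id f)) (sum-tabulate n f)

∑-cong : ∀ n {f g : Fin n → ℕ} → (∀ i → f i ≡ g i) → ∑[ i < n ] f i ≡ ∑[ i < n ] g i
∑-cong n = sum-cong-≗

∑-mono-≤ : ∀ n {f g : Fin n → ℕ} → (∀ i → f i ≤ g i) → ∑[ i < n ] f i ≤ ∑[ i < n ] g i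
∑-mono-≤ zero    f≤g = z≤n
∑-mono-≤ (suc n) f≤g = +-mono-≤ (f≤g Fin.zero) (∑-mono-≤ n (f≤g ∘ Fin.suc))

∑-const : ∀ n c → ∑[ i < n ] c ≡ n * c
∑-const zero    c = refl
∑-const (suc n) c = cong (c +_) (∑-const n c)

∑-*ˡ : ∀ n c (f : Fin n → ℕ) → ∑[ i < n ] (c * f i) ≡ c * ∑[ i < n ] f i
∑-*ˡ n c f = sym (*-distribˡ-sum c f)

term≤∑ : ∀ n (f : Fin n → ℕ) i → f i ≤ ∑[ j < n ] f j
term≤∑ (suc n) f Fin.zero    = m≤m+n (f Fin.zero) _
term≤∑ (suc n) f (Fin.suc i) = ≤-trans (term≤∑ n (f ∘ Fin.suc) i) (m≤n+m _ (f Fin.zero))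

∑ℕ : ℕ → (ℕ → ℕ) → ℕ
∑ℕ zero    g = 0
∑ℕ (suc k) g = g 0 + ∑ℕ k (g ∘ suc)

∑-toℕ : ∀ k (g : ℕ → ℕ) → ∑[ i < k ] g (toℕ i) ≡ ∑ℕ k g
∑-toℕ zero    g = refl
∑-toℕ (suc k) g = cong (g 0 +_) (∑-toℕ k (g ∘ suc))

∑ℕ-+ : ∀ a b g → ∑ℕ (a + b) g ≡ ∑ℕ a g + ∑ℕ b (g ∘ (a +_))
∑ℕ-+ zero    b g = refl
∑ℕ-+ (suc a) b g = trans (cong (g 0 +_) (∑ℕ-+ a b (g ∘ suc))) (sym (+-assoc (g 0) _ _))

∑ℕ-≤ : ∀ k g c → (∀ x → g x ≤ c) → ∑ℕ k g ≤ k * c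
∑ℕ-≤ zero    g c g≤c = z≤n
∑ℕ-≤ (suc k) g c g≤c = +-mono-≤ (g≤c 0) (∑ℕ-≤ k (g ∘ suc) c (g≤c ∘ suc))

indicator : Bool → ℕ
indicator b = if b then 1 else 0

#[_] : ∀ {n} → (Fin n → Bool) → ℕ
#[_] {n} p = ∑[ i < n ] indicator (p i)

count≡# : ∀ {n} (p : Fin n → Bool) → count p ≡ #[ p ]
count≡# {n} p = sum-allFin n (indicator ∘ p)

#-none : ∀ {n} (p : Fin n → Bool) → (∀ i → p i ≡ false) → #[ p ] ≡ 0
#-none {n} p none = trans (∑-cong n (cong indicator ∘ none)) (trans (∑-const n 0) (*-zeroʳ n))

#-atMostOne : ∀ {n} (p : Fin n → Bool) →
  (∀ i j → p i ≡ true → p j ≡ true → i ≡ j) → #[ p ] ≤ 1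
#-atMostOne {zero}  p unique = z≤n
#-atMostOne {suc n} p unique with p Fin.zero in p0
... | false = #-atMostOne (p ∘ Fin.suc) (λ i j pi pj → Finₚ.suc-injective (unique _ _ pi pj))
... | true  = ≤-reflexive (cong suc (#-none (p ∘ Fin.suc) rest))
  where
  rest : ∀ i → p (Fin.suc i) ≡ false
  rest i = ¬-not λ pi → Finₚ.0≢1+n (unique _ _ p0 pi)

#≤indicator : ∀ {n} (p : Fin n → Bool) b → (∀ i → p i ≡ true → b ≡ true) →
  (∀ i j → p i ≡ true → p j ≡ true → i ≡ j) → #[ p ] ≤ indicator b
#≤indicator p true  _     unique = #-atMostOne p unique
#≤indicator p false implies _    = ≤-reflexive (#-none p λ i → ¬-not λ pi → false≢true (implies i pi))
  where
  false≢true : false ≢ true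
  false≢true ()

any-allFin⁺ : ∀ {n} (p : Fin n → Bool) i → p i ≡ true → any p (allFin n) ≡ true
any-allFin⁺ p i pi =
  Equivalence.to T-≡ (any⁺ p (lose (∈-allFin i) (Equivalence.from T-≡ pi)))

any-allFin⁻ : ∀ {n} (p : Fin n → Bool) → any p (allFin n) ≡ true → ∃ λ i → p i ≡ true
any-allFin⁻ {n} p h with satisfied (any⁻ p (allFin n) (Equivalence.from T-≡ h))
... | i , pi = i , Equivalence.to T-≡ pi

∧-true : ∀ {s t} → (s ∧ t) ≡ true → (s ≡ true) × (t ≡ true)
∧-true {true} {true} _ = refl , refl

∨-true : ∀ {s t} → (s ∨ t) ≡ true → (s ≡ true) ⊎ (t ≡ true)
∨-true {true}  _ = inj₁ refl
∨-true {false} h = inj₂ h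

indicator-∧ : ∀ s t → indicator s * indicator t ≡ indicator (s ∧ t)
indicator-∧ false t     = refl
indicator-∧ true  false = refl
indicator-∧ true  true  = refl

indicator-≤-∨ : ∀ {s a b} → (s ≡ true → (a ≡ true) ⊎ (b ≡ true)) → indicator s ≤ indicator a + indicator b
indicator-≤-∨ {false} _ = z≤n
indicator-≤-∨ {true} {a} {b} split with split refl
... | inj₁ a≡true rewrite a≡true = s≤s z≤n
... | inj₂ b≡true rewrite b≡true = m≤n+m 1 (indicator a)

indicator≤1 : ∀ b → indicator b ≤ 1
indicator≤1 false = z≤n
indicator≤1 true  = s≤s z≤n

≡ᵇ-sound : ∀ {m n} → (m ≡ᵇ n) ≡ true → m ≡ n
≡ᵇ-sound {m} {n} h = ≡ᵇ⇒≡ m n (Equivalence.from T-≡ h)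

≡ᵇ-complete : ∀ {m n} → m ≡ n → (m ≡ᵇ n) ≡ true
≡ᵇ-complete {m} {n} eq = Equivalence.to T-≡ (≡⇒≡ᵇ m n eq)

sameVertex : ∀ {n} → Fin n → Fin n → Bool
sameVertex i j = toℕ i ≡ᵇ toℕ j

sameVertex-sound : ∀ {n} {i j : Fin n} → sameVertex i j ≡ true → i ≡ j
sameVertex-sound h = Finₚ.toℕ-injective (≡ᵇ-sound h)

sameVertex-refl : ∀ {n} (i : Fin n) → sameVertex i i ≡ true
sameVertex-refl i = ≡ᵇ-complete {toℕ i} refl

≡ᵇ-false : ∀ {m n} → (m ≡ᵇ n) ≡ false → m ≢ n
≡ᵇ-false {m} h refl with trans (sym h) (≡ᵇ-complete {m} refl)
... | ()

sameVertex-false : ∀ {n} {i j : Fin n} → sameVertex i j ≡ false → i ≢ j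
sameVertex-false h i≡j = ≡ᵇ-false h (cong toℕ i≡j)

module AdjacentPairs {n : ℕ} (G : Graph n) where

  adj-sym : ∀ {u v} → adj G u v ≡ true → adj G v u ≡ true
  adj-sym {u} {v} h = trans (Graph.sym G v u) h

  edge : Fin n → Fin n → ℕ
  edge v u = indicator (adj G v u)

  edge-sym : ∀ v u → edge v u ≡ edge u v
  edge-sym v u = cong indicator (Graph.sym G v u)

  degree-∑ : ∀ v → degree G v ≡ ∑[ u < n ] edge v u
  degree-∑ v = count≡# (adj G v)

  degreeSum : ℕ
  degreeSum = ∑[ v < n ] degree G v

  pairSum : (Fin n → Fin n → ℕ) → ℕ
  pairSum f = ∑[ v < n ] ∑[ u < n ] (edge v u * f v u)

  pairSum-cong : ∀ {f g} → (∀ v u → f v u ≡ g v u) → pairSum f ≡ pairSum g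
  pairSum-cong f≡g = ∑-cong n λ v → ∑-cong n λ u → cong (edge v u *_) (f≡g v u)

  pairSum-mono : ∀ {f g} → (∀ v u → adj G v u ≡ true → f v u ≤ g v u) → pairSum f ≤ pairSum g
  pairSum-mono {f} {g} f≤g = ∑-mono-≤ n λ v → ∑-mono-≤ n λ u → weighted v u
    where
    weighted : ∀ v u → edge v u * f v u ≤ edge v u * g v u
    weighted v u with adj G v u in vu
    ... | false = z≤n
    ... | true  = +-monoˡ-≤ 0 (f≤g v u vu)

  pairSum-+ : ∀ (f g : Fin n → Fin n → ℕ) → pairSum (λ v u → f v u + g v u) ≡ pairSum f + pairSum g
  pairSum-+ f g = begin
    ∑[ v < n ] ∑[ u < n ] (edge v u * (f v u + g v u))
      ≡⟨ ∑-cong n (λ v → ∑-cong n λ u → *-distribˡ-+ (edge v u) (f v u) (g v u)) ⟩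
    ∑[ v < n ] ∑[ u < n ] (edge v u * f v u + edge v u * g v u)
      ≡⟨ ∑-cong n (λ v → ∑-distrib-+ (λ u → edge v u * f v u) (λ u → edge v u * g v u)) ⟩
    ∑[ v < n ] (∑[ u < n ] (edge v u * f v u) + ∑[ u < n ] (edge v u * g v u))
      ≡⟨ ∑-distrib-+ (λ v → ∑[ u < n ] (edge v u * f v u)) (λ v → ∑[ u < n ] (edge v u * g v u)) ⟩
    pairSum f + pairSum g ∎
    where open ≡-Reasoning

  pairSum-flip : ∀ (f : Fin n → Fin n → ℕ) → pairSum (flip f) ≡ pairSum f
  pairSum-flip f = trans (∑-comm (λ v u → edge v u * f u v))
    (∑-cong n λ u → ∑-cong n λ v → cong (_* f u v) (edge-sym v u))

  pairSum-factor : ∀ (g h : Fin n → ℕ) → pairSum (λ v u → g v * h u) ≡ ∑[ v < n ] (g v * ∑[ u < n ] (edge v u * h u))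
  pairSum-factor g h = ∑-cong n λ v → trans
    (∑-cong n λ u → regroup (edge v u) (g v) (h u))
    (∑-*ˡ n (g v) (λ u → edge v u * h u))
    where
    regroup : ∀ e a b → e * (a * b) ≡ a * (e * b)
    regroup = solve-∀

  pairSum-vertex : ∀ (g : Fin n → ℕ) → pairSum (λ v _ → g v) ≡ ∑[ v < n ] (degree G v * g v)
  pairSum-vertex g = ∑-cong n λ v → begin
    ∑[ u < n ] (edge v u * g v)   ≡⟨ ∑-cong n (λ u → *-comm (edge v u) (g v)) ⟩
    ∑[ u < n ] (g v * edge v u)   ≡⟨ ∑-*ˡ n (g v) (edge v) ⟩
    g v * ∑[ u < n ] edge v u     ≡⟨ cong (g v *_) (sym (degree-∑ v)) ⟩
    g v * degree G v              ≡⟨ *-comm (g v) (degree G v) ⟩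
    degree G v * g v              ∎
    where open ≡-Reasoning

-- A vertex w ≠ v reached from v by a path v u w is at distance exactly 2
-- (no triangles), and through only one middle vertex u (no 4-cycles).
-- Every neighbour u of v has d_u - 1 neighbours other than v.

module Acyclicity {n : ℕ} (G : Graph n) (acyclic : Acyclic G) where

  open AdjacentPairs G

  adj⇒≢ : ∀ {u v} → adj G u v ≡ true → u ≢ v
  adj⇒≢ {u} h refl with trans (sym h) (irrefl G u)
  ... | ()

  no-triangle : ∀ {v u w} → adj G v u ≡ true → adj G u w ≡ true → adj G v w ≡ true → ⊥
  no-triangle {v} {u} {w} vu uw vw = acyclic (v ∷ u ∷ w ∷ [])
    ( s≤s (s≤s (s≤s z≤n))
    , ((adj⇒≢ vu ∷ adj⇒≢ vw ∷ []) ∷ (adj⇒≢ uw ∷ []) ∷ [] ∷ [])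
    , (vu ∷ uw ∷ adj-sym vw ∷ [-]))

  no-square : ∀ {v u₁ w u₂} → v ≢ w → u₁ ≢ u₂ →
    adj G v u₁ ≡ true → adj G u₁ w ≡ true → adj G v u₂ ≡ true → adj G u₂ w ≡ true → ⊥
  no-square {v} {u₁} {w} {u₂} v≢w u₁≢u₂ vu₁ u₁w vu₂ u₂w = acyclic (v ∷ u₁ ∷ w ∷ u₂ ∷ [])
    ( s≤s (s≤s (s≤s z≤n))
    , ( (adj⇒≢ vu₁ ∷ v≢w ∷ adj⇒≢ vu₂ ∷ [])
      ∷ (adj⇒≢ u₁w ∷ u₁≢u₂ ∷ [])
      ∷ ((λ w≡u₂ → adj⇒≢ u₂w (sym w≡u₂)) ∷ [])
      ∷ [] ∷ [])
    , (vu₁ ∷ u₁w ∷ adj-sym u₂w ∷ adj-sym vu₂ ∷ [-]))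

  path2 : Fin n → Fin n → Fin n → Bool
  path2 v w u = adj G v u ∧ adj G u w ∧ not (sameVertex v w)

  path2-parts : ∀ {v w u} → path2 v w u ≡ true →
    (adj G v u ≡ true) × (adj G u w ≡ true) × (sameVertex v w ≡ false)
  path2-parts h = parts _ _ _ h
    where
    parts : ∀ a b c → (a ∧ b ∧ not c) ≡ true → (a ≡ true) × (b ≡ true) × (c ≡ false)
    parts true true false _ = refl , refl , refl

  path2⇒dist2 : ∀ {v w u} → path2 v w u ≡ true → dist2 G v w ≡ true
  path2⇒dist2 {v} {w} {u} h with path2-parts h
  ... | vu , uw , v≠w rewrite v≠w with adj G v w in vw
  ...   | true  = ⊥-elim (no-triangle vu uw vw)
  ...   | false = any-allFin⁺ (λ x → adj G v x ∧ adj G x w) u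
                    (subst₂ (λ s t → (s ∧ t) ≡ true) (sym vu) (sym uw) refl)

  path2-unique : ∀ v w x y → path2 v w x ≡ true → path2 v w y ≡ true → x ≡ y
  path2-unique v w x y hx hy with x Finₚ.≟ y
  ... | yes x≡y = x≡y
  ... | no  x≢y with path2-parts hx | path2-parts hy
  ...   | vx , xw , v≠w | vy , yw , _ = ⊥-elim (no-square (sameVertex-false v≠w) x≢y vx xw vy yw)

  paths2≤dist2 : ∀ v w → #[ path2 v w ] ≤ indicator (dist2 G v w)
  paths2≤dist2 v w = #≤indicator (path2 v w) (dist2 G v w) (λ _ → path2⇒dist2) (path2-unique v w)

  degree≤1+others : ∀ v u → degree G u ≤ 1 + #[ (λ w → adj G u w ∧ not (sameVertex v w)) ]
  degree≤1+others v u = begin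
    degree G u                                  ≡⟨ degree-∑ u ⟩
    ∑[ w < n ] indicator (adj G u w)            ≤⟨ ∑-mono-≤ n (λ w → split (adj G u w) (sameVertex v w)) ⟩
    ∑[ w < n ] (indicator (sameVertex v w) + indicator (adj G u w ∧ not (sameVertex v w)))
                                                ≡⟨ ∑-distrib-+ (λ w → indicator (sameVertex v w)) _ ⟩
    #[ sameVertex v ] + #[ (λ w → adj G u w ∧ not (sameVertex v w)) ]
                                                ≤⟨ +-monoˡ-≤ _ (#-atMostOne (sameVertex v) onlyV) ⟩
    1 + #[ (λ w → adj G u w ∧ not (sameVertex v w)) ] ∎
    where
    open ≤-Reasoning
    split : ∀ a b → indicator a ≤ indicator b + indicator (a ∧ not b)
    split false b     = z≤n
    split true  false = ≤-refl
    split true  true  = ≤-refl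
    onlyV : ∀ x y → sameVertex v x ≡ true → sameVertex v y ≡ true → x ≡ y
    onlyV x y vx vy = trans (sym (sameVertex-sound {i = v} vx)) (sameVertex-sound {i = v} vy)

  τ-lower : ∀ v → ∑[ u < n ] (edge v u * (degree G u ∸ 1)) ≤ τ G v
  τ-lower v = begin
    ∑[ u < n ] (edge v u * (degree G u ∸ 1))
      ≤⟨ ∑-mono-≤ n (λ u → *-monoʳ-≤ (edge v u) (m≤n+o⇒m∸n≤o (degree G u) 1 (degree≤1+others v u))) ⟩
    ∑[ u < n ] (edge v u * #[ (λ w → adj G u w ∧ not (sameVertex v w)) ])
      ≡⟨ ∑-cong n (λ u → sym (∑-*ˡ n (edge v u) _)) ⟩
    ∑[ u < n ] ∑[ w < n ] (edge v u * indicator (adj G u w ∧ not (sameVertex v w)))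
      ≡⟨ ∑-cong n (λ u → ∑-cong n λ w → indicator-∧ (adj G v u) _) ⟩
    ∑[ u < n ] ∑[ w < n ] indicator (path2 v w u)
      ≡⟨ ∑-comm (λ u w → indicator (path2 v w u)) ⟩
    ∑[ w < n ] #[ path2 v w ]
      ≤⟨ ∑-mono-≤ n (paths2≤dist2 v) ⟩
    #[ dist2 G v ]
      ≡⟨ count≡# (dist2 G v) ⟨
    τ G v ∎
    where open ≤-Reasoning

eventually-all : ∀ m (Q : Fin m → ℕ → Set) → (∀ i {k k′} → k ≤ k′ → Q i k → Q i k′) →
  (∀ i → ∃ (Q i)) → ∃ λ K → ∀ i → Q i K
eventually-all zero    Q upward holds = 0 , λ ()
eventually-all (suc m) Q upward holds
  with holds Fin.zero | eventually-all m (Q ∘ Fin.suc) (upward ∘ Fin.suc) (holds ∘ Fin.suc)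
... | k₀ , q₀ | K , qs = k₀ + K , λ
  { Fin.zero    → upward Fin.zero (m≤m+n k₀ K) q₀
  ; (Fin.suc i) → upward (Fin.suc i) (m≤n+m K k₀) (qs i) }

-- Grow the set reached k of vertices within k steps of a root.  Every vertex
-- added in a round has a neighbour reached before, which adds two new ordered
-- adjacent pairs inside the reached set; hence 2 · #reached ≤ #pairs + 2.

module Connectivity {n : ℕ} (G : Graph n) (root : Fin n) where

  open AdjacentPairs G

  nextTo : (Fin n → Bool) → Fin n → Bool
  nextTo R v = any (λ u → R u ∧ adj G u v) (allFin n)

  reached : ℕ → Fin n → Bool
  reached zero    v = sameVertex v root
  reached (suc k) v = reached k v ∨ nextTo (reached k) v

  new : ℕ → Fin n → Bool
  new k v = not (reached k v) ∧ nextTo (reached k) v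

  reached-step : ∀ k v → reached k v ≡ true → reached (suc k) v ≡ true
  reached-step k v h rewrite h = refl

  reached-mono : ∀ v {k k′} → k ≤ k′ → reached k v ≡ true → reached k′ v ≡ true
  reached-mono v {k} k≤k′ h = go (≤⇒≤′ k≤k′)
    where
    go : ∀ {k′} → k ≤′ k′ → reached k′ v ≡ true
    go ≤′-refl                    = h
    go (≤′-step {k′} k≤′k′) = reached-step k′ v (go k≤′k′)

  walk⇒reached : ∀ {u v} → Walk G u v → ∀ k → reached k u ≡ true → ∃ λ k′ → reached k′ v ≡ true
  walk⇒reached here               k h = k , h
  walk⇒reached (step {w = w} uw rest) k h = walk⇒reached rest (suc k) (∨-introʳ (reached k w)
    (any-allFin⁺ (λ x → reached k x ∧ adj G x w) _ (subst₂ (λ s t → (s ∧ t) ≡ true) (sym h) (sym uw) refl)))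
    where
    ∨-introʳ : ∀ s {t} → t ≡ true → (s ∨ t) ≡ true
    ∨-introʳ true  _ = refl
    ∨-introʳ false h = h

  eventually-everything : Connected G → ∃ λ K → ∀ v → reached K v ≡ true
  eventually-everything connected = eventually-all n (λ v k → reached k v ≡ true) reached-mono
    (λ v → walk⇒reached (connected root v) 0 (sameVertex-refl root))

  member : ℕ → Fin n → ℕ
  member k v = indicator (reached k v)

  fresh : ℕ → Fin n → ℕ
  fresh k v = indicator (new k v)

  member-suc : ∀ k v → member (suc k) v ≡ member k v + fresh k v
  member-suc k v with reached k v
  ... | true  = refl
  ... | false = refl

  reachedCount-suc : ∀ k → #[ reached (suc k) ] ≡ #[ reached k ] + #[ new k ]
  reachedCount-suc k = trans (∑-cong n (member-suc k)) (∑-distrib-+ (member k) (fresh k))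

  internalPairs : ℕ → ℕ
  internalPairs k = pairSum (λ x y → member k x * member k y)

  internalPairs≤degreeSum : ∀ k → internalPairs k ≤ degreeSum
  internalPairs≤degreeSum k = begin
    internalPairs k            ≤⟨ pairSum-mono (λ x y _ → *-mono-≤ (indicator≤1 (reached k x)) (indicator≤1 (reached k y))) ⟩
    pairSum (λ _ _ → 1)        ≡⟨ pairSum-vertex (λ _ → 1) ⟩
    ∑[ v < n ] (degree G v * 1) ≡⟨ ∑-cong n (λ v → *-identityʳ (degree G v)) ⟩
    degreeSum                  ∎
    where open ≤-Reasoning

  -- Each new vertex is adjacent to a previously reached one.
  new-attached : ∀ k → #[ new k ] ≤ pairSum (λ x y → fresh k x * member k y)
  new-attached k = begin
    ∑[ x < n ] fresh k x
      ≤⟨ ∑-mono-≤ n attached ⟩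
    ∑[ x < n ] (fresh k x * ∑[ y < n ] (edge x y * member k y))
      ≡⟨ pairSum-factor (fresh k) (member k) ⟨
    pairSum (λ x y → fresh k x * member k y) ∎
    where
    open ≤-Reasoning
    attached : ∀ x → fresh k x ≤ fresh k x * ∑[ y < n ] (edge x y * member k y)
    attached x with new k x in isNew
    ... | false = z≤n
    ... | true  with ∧-true {not (reached k x)} isNew
    ...   | _ , nbr with any-allFin⁻ (λ u → reached k u ∧ adj G u x) nbr
    ...     | u , hu with ∧-true {reached k u} hu
    ...       | uReached , ux = +-monoˡ-≤ 0 (≤-trans
                (≤-reflexive (sym (cong₂ (λ s t → indicator s * indicator t) (adj-sym ux) uReached)))
                (term≤∑ n (λ y → edge x y * member k y) u))

  internalPairs-step : ∀ k → internalPairs k + 2 * #[ new k ] ≤ internalPairs (suc k)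
  internalPairs-step k = begin
    internalPairs k + 2 * #[ new k ]
      ≡⟨ cong (internalPairs k +_) (cong (#[ new k ] +_) (+-identityʳ _)) ⟩
    internalPairs k + (#[ new k ] + #[ new k ])
      ≤⟨ +-monoʳ-≤ (internalPairs k) (+-mono-≤ (new-attached k) (new-attached k)) ⟩
    internalPairs k + (cross + cross)
      ≡⟨ cong (λ z → internalPairs k + (z + cross)) cross-sym ⟨
    internalPairs k + (cross′ + cross)
      ≡⟨ +-assoc (internalPairs k) cross′ cross ⟨
    internalPairs k + cross′ + cross
      ≡⟨ cong (_+ cross) (pairSum-+ (λ x y → a x * a y) (λ x y → a x * ν y)) ⟨
    pairSum (λ x y → a x * a y + a x * ν y) + cross
      ≡⟨ pairSum-+ (λ x y → a x * a y + a x * ν y) (λ x y → ν x * a y) ⟨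
    pairSum (λ x y → a x * a y + a x * ν y + ν x * a y)
      ≤⟨ pairSum-mono (λ x y _ → expand (a x) (ν x) (a y) (ν y)) ⟩
    pairSum (λ x y → (a x + ν x) * (a y + ν y))
      ≡⟨ pairSum-cong (λ x y → cong₂ _*_ (member-suc k x) (member-suc k y)) ⟨
    internalPairs (suc k) ∎
    where
    open ≤-Reasoning
    a ν : Fin n → ℕ
    a = member k
    ν = fresh k
    cross′ cross : ℕ
    cross′ = pairSum (λ x y → a x * ν y)
    cross  = pairSum (λ x y → ν x * a y)
    cross-sym : cross′ ≡ cross
    cross-sym = trans (pairSum-cong λ x y → *-comm (a x) (ν y)) (pairSum-flip (λ x y → ν x * a y))
    expand : ∀ a b c d → a * c + a * d + b * c ≤ (a + b) * (c + d)
    expand a b c d = ≤-trans (m≤m+n _ (b * d)) (≤-reflexive (multiplyOut a b c d))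
      where
      multiplyOut : ∀ a b c d → a * c + a * d + b * c + b * d ≡ (a + b) * (c + d)
      multiplyOut = solve-∀

  reached-invariant : ∀ k → 2 * #[ reached k ] ≤ internalPairs k + 2
  reached-invariant zero = ≤-trans
    (*-monoʳ-≤ 2 (#-atMostOne (reached zero) onlyRoot)) (m≤n+m 2 (internalPairs zero))
    where
    onlyRoot : ∀ x y → sameVertex x root ≡ true → sameVertex y root ≡ true → x ≡ y
    onlyRoot x y xr yr = trans (sameVertex-sound {j = root} xr) (sym (sameVertex-sound {j = root} yr))
  reached-invariant (suc k) = begin
    2 * #[ reached (suc k) ]                    ≡⟨ cong (2 *_) (reachedCount-suc k) ⟩
    2 * (#[ reached k ] + #[ new k ])           ≡⟨ *-distribˡ-+ 2 #[ reached k ] #[ new k ] ⟩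
    2 * #[ reached k ] + 2 * #[ new k ]         ≤⟨ +-monoˡ-≤ _ (reached-invariant k) ⟩
    internalPairs k + 2 + 2 * #[ new k ]        ≡⟨ +-rearrange (internalPairs k) 2 (2 * #[ new k ]) ⟩
    internalPairs k + 2 * #[ new k ] + 2        ≤⟨ +-monoˡ-≤ 2 (internalPairs-step k) ⟩
    internalPairs (suc k) + 2                   ∎
    where
    open ≤-Reasoning
    +-rearrange : ∀ a b c → a + b + c ≡ a + c + b
    +-rearrange = solve-∀

degreeSum-lower : ∀ {n} (G : Graph n) → Connected G → 2 * n ≤ AdjacentPairs.degreeSum G + 2
degreeSum-lower {zero}  G connected = z≤n
degreeSum-lower {suc n} G connected
  with Connectivity.eventually-everything G Fin.zero connected
... | K , everything = begin
  2 * suc n                  ≡⟨ cong (2 *_) allReached ⟨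
  2 * #[ reached K ]         ≤⟨ reached-invariant K ⟩
  internalPairs K + 2        ≤⟨ +-monoˡ-≤ 2 (internalPairs≤degreeSum K) ⟩
  degreeSum + 2              ∎
  where
  open ≤-Reasoning
  open Connectivity G Fin.zero
  open AdjacentPairs G using (degreeSum)
  allReached : #[ reached K ] ≡ suc n
  allReached = trans (∑-cong (suc n) (cong indicator ∘ everything)) (trans (∑-const (suc n) 1) (*-identityʳ (suc n)))

-- Every edge uv of a tree contributes d_u(d_v - 1) + d_v(d_u - 1) to ZC₁*.
-- We charge to each endpoint of an edge the amount  share(degree), so that
-- (i) an edge (plus 2) pays for the shares of its two endpoints, and
-- (ii) a vertex of degree d collects d · share d ≥ 6d - 6.

share : ℕ → ℕ
share 0 = 0
share 1 = 0
share 2 = 3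
share 3 = 4
share 4 = 5
share (suc (suc (suc (suc (suc _))))) = 6

share≤1+deg : ∀ d → share (suc d) ≤ d + 2
share≤1+deg 0 = z≤n
share≤1+deg 1 = ≤-refl
share≤1+deg 2 = ≤-refl
share≤1+deg 3 = ≤-refl
share≤1+deg (suc (suc (suc (suc d)))) = ≤-trans (m≤n+m 6 d) (≤-reflexive (rearrange d))
  where
  rearrange : ∀ d → d + 6 ≡ suc (suc (suc (suc d))) + 2
  rearrange = solve-∀

share-edge : ∀ a b → 1 ≤ a → 1 ≤ b → share a + share b ≤ a * (b ∸ 1) + b * (a ∸ 1) + 2
share-edge (suc zero) (suc b) _ _ = ≤-trans (share≤1+deg b) (≤-reflexive (rearrange b))
  where
  rearrange : ∀ b → b + 2 ≡ 1 * b + suc b * 0 + 2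
  rearrange = solve-∀
share-edge (suc (suc a)) (suc zero) _ _ =
  ≤-trans (≤-reflexive (+-identityʳ _)) (≤-trans (share≤1+deg (suc a)) (≤-reflexive (rearrange a)))
  where
  rearrange : ∀ a → suc a + 2 ≡ suc (suc a) * 0 + 1 * suc a + 2
  rearrange = solve-∀
share-edge (suc (suc a)) (suc (suc b)) _ _ = begin
  share (2 + a) + share (2 + b)                    ≤⟨ +-mono-≤ (share≤1+deg (suc a)) (share≤1+deg (suc b)) ⟩
  (suc a + 2) + (suc b + 2)                        ≤⟨ m≤m+n _ (2 * (a * b) + 2 * a + 2 * b) ⟩
  (suc a + 2) + (suc b + 2) + (2 * (a * b) + 2 * a + 2 * b) ≡⟨ rearrange a b ⟩
  (2 + a) * suc b + (2 + b) * suc a + 2            ∎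
  where
  open ≤-Reasoning
  rearrange : ∀ a b → (suc a + 2) + (suc b + 2) + (2 * (a * b) + 2 * a + 2 * b)
                    ≡ (2 + a) * suc b + (2 + b) * suc a + 2
  rearrange = solve-∀

share-vertex : ∀ d → 6 * d ≤ d * share d + 6
share-vertex 0 = z≤n
share-vertex 1 = ≤-refl
share-vertex 2 = ≤-refl
share-vertex 3 = ≤-refl
share-vertex 4 = m≤m+n 24 2
share-vertex d@(suc (suc (suc (suc (suc _))))) = ≤-trans (≤-reflexive (*-comm 6 d)) (m≤m+n _ 6)

module TreeBound {n : ℕ} (G : Graph n) (acyclic : Acyclic G) where

  open AdjacentPairs G
  open Acyclicity G acyclic using (τ-lower)

  d : Fin n → ℕ
  d = degree G

  -- contribution of the ordered adjacent pair (v , u) to d_v τ_v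
  excess : Fin n → Fin n → ℕ
  excess v u = d v * (d u ∸ 1)

  excess≤ZC : pairSum excess ≤ ZC1* G
  excess≤ZC = begin
    pairSum excess                                       ≡⟨ pairSum-factor d (λ u → d u ∸ 1) ⟩
    ∑[ v < n ] (d v * ∑[ u < n ] (edge v u * (d u ∸ 1))) ≤⟨ ∑-mono-≤ n (λ v → *-monoʳ-≤ (d v) (τ-lower v)) ⟩
    ∑[ v < n ] (d v * τ G v)                             ≡⟨ sum-allFin n (λ v → d v * τ G v) ⟨
    ZC1* G                                               ∎
    where open ≤-Reasoning

  degree-pos : ∀ {v u} → adj G v u ≡ true → 1 ≤ d v
  degree-pos {v} {u} vu = begin
    1                         ≡⟨ cong indicator vu ⟨
    edge v u                  ≤⟨ term≤∑ n (edge v) u ⟩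
    ∑[ w < n ] edge v w       ≡⟨ degree-∑ v ⟨
    d v                       ∎
    where open ≤-Reasoning

  shares : ℕ
  shares = ∑[ v < n ] (d v * share (d v))

  shares-paid : shares ≤ pairSum excess + degreeSum
  shares-paid = *-cancelˡ-≤ 2 (begin
    2 * shares                                              ≡⟨ double shares ⟩
    shares + shares                                         ≡⟨ cong₂ _+_ sharesAtFirst (trans sharesAtFirst (sym (pairSum-flip (λ v _ → share (d v))))) ⟩
    pairSum (λ v _ → share (d v)) + pairSum (λ _ u → share (d u))
                                                            ≡⟨ pairSum-+ (λ v _ → share (d v)) (λ _ u → share (d u)) ⟨
    pairSum (λ v u → share (d v) + share (d u))             ≤⟨ pairSum-mono (λ v u vu → share-edge (d v) (d u) (degree-pos vu) (degree-pos (adj-sym vu))) ⟩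
    pairSum (λ v u → excess v u + excess u v + 2)           ≡⟨ pairSum-+ (λ v u → excess v u + excess u v) (λ _ _ → 2) ⟩
    pairSum (λ v u → excess v u + excess u v) + pairSum (λ _ _ → 2)
                                                            ≡⟨ cong₂ _+_ (pairSum-+ excess (flip excess)) twoPerPair ⟩
    pairSum excess + pairSum (flip excess) + 2 * degreeSum  ≡⟨ cong (λ z → pairSum excess + z + 2 * degreeSum) (pairSum-flip excess) ⟩
    pairSum excess + pairSum excess + 2 * degreeSum         ≡⟨ regroup (pairSum excess) degreeSum ⟩
    2 * (pairSum excess + degreeSum)                        ∎)
    where
    open ≤-Reasoning
    sharesAtFirst : shares ≡ pairSum (λ v _ → share (d v))
    sharesAtFirst = sym (pairSum-vertex (λ v → share (d v)))
    twoPerPair : pairSum (λ _ _ → 2) ≡ 2 * degreeSum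
    twoPerPair = trans (pairSum-vertex (λ _ → 2))
                       (trans (∑-cong n (λ v → *-comm (d v) 2)) (∑-*ˡ n 2 d))
    double : ∀ x → 2 * x ≡ x + x
    double = solve-∀
    regroup : ∀ x y → x + x + 2 * y ≡ 2 * (x + y)
    regroup = solve-∀

  shares-collected : 6 * degreeSum ≤ shares + n * 6
  shares-collected = begin
    6 * degreeSum                         ≡⟨ ∑-*ˡ n 6 d ⟨
    ∑[ v < n ] (6 * d v)                  ≤⟨ ∑-mono-≤ n (λ v → share-vertex (d v)) ⟩
    ∑[ v < n ] (d v * share (d v) + 6)    ≡⟨ ∑-distrib-+ (λ v → d v * share (d v)) (λ _ → 6) ⟩
    shares + ∑[ v < n ] 6                 ≡⟨ cong (shares +_) (∑-const n 6) ⟩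
    shares + n * 6                        ∎
    where open ≤-Reasoning

tree-arithmetic : ∀ Z D n → 6 * D ≤ Z + D + n * 6 → 2 * n ≤ D + 2 → 4 * n ≤ Z + 10
tree-arithmetic Z D n shares≤ connected = +-cancelˡ-≤ (6 * n) (4 * n) (Z + 10) (begin
  6 * n + 4 * n    ≡⟨ regroup₁ n ⟩
  5 * (2 * n)      ≤⟨ *-monoʳ-≤ 5 connected ⟩
  5 * (D + 2)      ≡⟨ regroup₂ D ⟩
  5 * D + 10       ≤⟨ +-monoˡ-≤ 10 fiveD≤ ⟩
  Z + n * 6 + 10   ≡⟨ regroup₃ Z n ⟩
  6 * n + (Z + 10) ∎)
  where
  open ≤-Reasoning
  regroup₁ : ∀ n → 6 * n + 4 * n ≡ 5 * (2 * n)
  regroup₁ = solve-∀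
  regroup₂ : ∀ D → 5 * (D + 2) ≡ 5 * D + 10
  regroup₂ = solve-∀
  regroup₃ : ∀ Z n → Z + n * 6 + 10 ≡ 6 * n + (Z + 10)
  regroup₃ = solve-∀
  fiveD≤ : 5 * D ≤ Z + n * 6
  fiveD≤ = +-cancelˡ-≤ D (5 * D) (Z + n * 6) (subst₂ _≤_ (split D) (rearrange Z D n) shares≤)
    where
    split : ∀ D → 6 * D ≡ D + 5 * D
    split = solve-∀
    rearrange : ∀ Z D n → Z + D + n * 6 ≡ D + (Z + n * 6)
    rearrange = solve-∀

tree-lower : ∀ {n} (T : Graph n) → IsTree T → 4 * n ≤ ZC1* T + 10
tree-lower {n} T (connected , acyclic) =
  tree-arithmetic (ZC1* T) degreeSum n sixD≤ (degreeSum-lower T connected)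
  where
  open AdjacentPairs T using (degreeSum)
  open TreeBound T acyclic
  sixD≤ : 6 * degreeSum ≤ ZC1* T + degreeSum + n * 6
  sixD≤ = ≤-trans shares-collected
    (+-monoˡ-≤ (n * 6) (≤-trans shares-paid (+-monoˡ-≤ degreeSum excess≤ZC)))

-- The vertex at position m of P_n has at most one neighbour on each side and
-- at most one vertex at distance two on each side; near the two ends some of
-- these are missing, which saves 3 + 2 + 2 + 3 = 10 from the crude bound 4n.

module PathBound (n : ℕ) where

  isAhead isBehind : ℕ → ℕ → Fin n → Bool
  isAhead  k m j = k + m ≡ᵇ toℕ j
  isBehind k m j = k + toℕ j ≡ᵇ m

  ahead behind : ℕ → ℕ → ℕ
  ahead  k m = #[ isAhead k m ]
  behind k m = #[ isBehind k m ]

  ahead≤1 : ∀ k m → ahead k m ≤ 1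
  ahead≤1 k m = #-atMostOne (isAhead k m) λ i j hi hj →
    Finₚ.toℕ-injective (trans (sym (≡ᵇ-sound {k + m} hi)) (≡ᵇ-sound {k + m} hj))

  behind≤1 : ∀ k m → behind k m ≤ 1
  behind≤1 k m = #-atMostOne (isBehind k m) λ i j hi hj →
    Finₚ.toℕ-injective (+-cancelˡ-≡ k _ _ (trans (≡ᵇ-sound {n = m} hi) (sym (≡ᵇ-sound {n = m} hj))))

  ahead-outside : ∀ k m → n ≤ k + m → ahead k m ≡ 0
  ahead-outside k m n≤ = #-none (isAhead k m) λ j → ¬-not λ h →
    <⇒≱ (Finₚ.toℕ<n j) (subst (n ≤_) (≡ᵇ-sound {k + m} h) n≤)

  behind-outside : ∀ k m → m < k → behind k m ≡ 0
  behind-outside k m m<k = #-none (isBehind k m) λ j → ¬-not λ h →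
    <⇒≱ m<k (subst (k ≤_) (≡ᵇ-sound {n = m} h) (m≤m+n k (toℕ j)))

  adjacent-positions : ∀ {i j : Fin n} → pathAdj i j ≡ true → (1 + toℕ i ≡ toℕ j) ⊎ (1 + toℕ j ≡ toℕ i)
  adjacent-positions h with ∨-true h
  ... | inj₁ right = inj₁ (≡ᵇ-sound right)
  ... | inj₂ left  = inj₂ (≡ᵇ-sound left)

  distance2-positions : ∀ i j → dist2 (P n) i j ≡ true → (2 + toℕ i ≡ toℕ j) ⊎ (2 + toℕ j ≡ toℕ i)
  distance2-positions i j h with ∧-true {not (sameVertex i j)} h
  ... | i≠j , rest with ∧-true {not (pathAdj i j)} rest
  ...   | _ , common with any-allFin⁻ (λ w → pathAdj i w ∧ pathAdj w j) common
  ...     | w , iwj with ∧-true {pathAdj i w} iwj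
  ...       | iw , wj with adjacent-positions {i} {w} iw | adjacent-positions {w} {j} wj
  ...         | inj₁ i→w | inj₁ w→j = inj₁ (trans (cong suc i→w) w→j)
  ...         | inj₂ w→i | inj₂ j→w = inj₂ (trans (cong suc j→w) w→i)
  ...         | inj₁ i→w | inj₂ j→w = ⊥-elim (≡ᵇ-false (not-injective i≠j) (suc-injective (trans i→w (sym j→w))))
  ...         | inj₂ w→i | inj₁ w→j = ⊥-elim (≡ᵇ-false (not-injective i≠j) (trans (sym w→i) w→j))

  degree-path : ∀ i → degree (P n) i ≤ ahead 1 (toℕ i) + behind 1 (toℕ i)
  degree-path i = begin
    degree (P n) i    ≡⟨ count≡# (pathAdj i) ⟩
    #[ pathAdj i ]    ≤⟨ ∑-mono-≤ n (λ j → indicator-≤-∨ (sides j)) ⟩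
    ∑[ j < n ] (indicator (isAhead 1 (toℕ i) j) + indicator (isBehind 1 (toℕ i) j))
                      ≡⟨ ∑-distrib-+ (indicator ∘ isAhead 1 (toℕ i)) (indicator ∘ isBehind 1 (toℕ i)) ⟩
    ahead 1 (toℕ i) + behind 1 (toℕ i) ∎
    where
    open ≤-Reasoning
    sides : ∀ j → pathAdj i j ≡ true → (isAhead 1 (toℕ i) j ≡ true) ⊎ (isBehind 1 (toℕ i) j ≡ true)
    sides j = ∨-true

  τ-path : ∀ i → τ (P n) i ≤ ahead 2 (toℕ i) + behind 2 (toℕ i)
  τ-path i = begin
    τ (P n) i           ≡⟨ count≡# (dist2 (P n) i) ⟩
    #[ dist2 (P n) i ]  ≤⟨ ∑-mono-≤ n (λ j → indicator-≤-∨ (sides j)) ⟩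
    ∑[ j < n ] (indicator (isAhead 2 (toℕ i) j) + indicator (isBehind 2 (toℕ i) j))
                        ≡⟨ ∑-distrib-+ (indicator ∘ isAhead 2 (toℕ i)) (indicator ∘ isBehind 2 (toℕ i)) ⟩
    ahead 2 (toℕ i) + behind 2 (toℕ i) ∎
    where
    open ≤-Reasoning
    sides : ∀ j → dist2 (P n) i j ≡ true → (isAhead 2 (toℕ i) j ≡ true) ⊎ (isBehind 2 (toℕ i) j ≡ true)
    sides j h with distance2-positions i j h
    ... | inj₁ i→j = inj₁ (≡ᵇ-complete i→j)
    ... | inj₂ j→i = inj₂ (≡ᵇ-complete j→i)

  weight : ℕ → ℕ
  weight m = (ahead 1 m + behind 1 m) * (ahead 2 m + behind 2 m)

  ZC-path≤ : ZC1* (P n) ≤ ∑ℕ n weight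
  ZC-path≤ = begin
    ZC1* (P n)                                     ≡⟨ sum-allFin n (λ i → degree (P n) i * τ (P n) i) ⟩
    ∑[ i < n ] (degree (P n) i * τ (P n) i)        ≤⟨ ∑-mono-≤ n (λ i → *-mono-≤ (degree-path i) (τ-path i)) ⟩
    ∑[ i < n ] weight (toℕ i)                      ≡⟨ ∑-toℕ n weight ⟩
    ∑ℕ n weight                                    ∎
    where open ≤-Reasoning

  private
    weight-bound : ∀ {m A B C D} → ahead 1 m ≤ A → behind 1 m ≤ B → ahead 2 m ≤ C → behind 2 m ≤ D →
      weight m ≤ (A + B) * (C + D)
    weight-bound a b c d = *-mono-≤ (+-mono-≤ a b) (+-mono-≤ c d)

  weight≤4 : ∀ m → weight m ≤ 4
  weight≤4 m = weight-bound (ahead≤1 1 m) (behind≤1 1 m) (ahead≤1 2 m) (behind≤1 2 m)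

  weight-first : weight 0 ≤ 1
  weight-first = weight-bound {A = 1} {B = 0} {C = 1} {D = 0}
    (ahead≤1 1 0) (≤-reflexive (behind-outside 1 0 (s≤s z≤n)))
    (ahead≤1 2 0) (≤-reflexive (behind-outside 2 0 (s≤s z≤n)))

  weight-second : weight 1 ≤ 2
  weight-second = weight-bound {A = 1} {B = 1} {C = 1} {D = 0}
    (ahead≤1 1 1) (behind≤1 1 1) (ahead≤1 2 1) (≤-reflexive (behind-outside 2 1 (s≤s (s≤s z≤n))))

  weight-penultimate : ∀ m → n ≤ 2 + m → weight m ≤ 2
  weight-penultimate m n≤ = weight-bound {A = 1} {B = 1} {C = 0} {D = 1}
    (ahead≤1 1 m) (behind≤1 1 m) (≤-reflexive (ahead-outside 2 m n≤)) (behind≤1 2 m)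

  weight-last : ∀ m → n ≤ 1 + m → weight m ≤ 1
  weight-last m n≤ = weight-bound {A = 0} {B = 1} {C = 0} {D = 1}
    (≤-reflexive (ahead-outside 1 m n≤)) (behind≤1 1 m)
    (≤-reflexive (ahead-outside 2 m (≤-trans n≤ (n≤1+n _)))) (behind≤1 2 m)

-- ZC₁*(P_n) ≤ 4n - 10 for n = 4 + m (in fact equality holds).
path-upper : ∀ m → ZC1* (P (4 + m)) + 10 ≤ 4 * (4 + m)
path-upper m = begin
  ZC1* (P (4 + m)) + 10
    ≤⟨ +-monoˡ-≤ 10 ZC-path≤ ⟩
  w 0 + (w 1 + ∑ℕ (2 + m) inner) + 10
    ≡⟨ cong (λ k → w 0 + (w 1 + ∑ℕ k inner) + 10) (+-comm 2 m) ⟩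
  w 0 + (w 1 + ∑ℕ (m + 2) inner) + 10
    ≡⟨ cong (λ s → w 0 + (w 1 + s) + 10) (∑ℕ-+ m 2 inner) ⟩
  w 0 + (w 1 + (∑ℕ m inner + (w (2 + (m + 0)) + (w (2 + (m + 1)) + 0)))) + 10
    ≤⟨ +-monoˡ-≤ 10 (+-mono-≤ weight-first (+-mono-≤ weight-second (+-mono-≤
         (∑ℕ-≤ m inner 4 (weight≤4 ∘ (2 +_)))
         (+-mono-≤ (weight-penultimate _ (≤-reflexive (cong (4 +_) (sym (+-identityʳ m)))))
                   (+-monoˡ-≤ 0 (weight-last _ (≤-reflexive (cong (3 +_) (+-comm 1 m))))))))) ⟩
  1 + (2 + (m * 4 + (2 + (1 + 0)))) + 10
    ≡⟨ total m ⟩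
  4 * (4 + m) ∎
  where
  open ≤-Reasoning
  open PathBound (4 + m)
  w inner : ℕ → ℕ
  w = weight
  inner x = weight (2 + x)
  total : ∀ m → 1 + (2 + (m * 4 + (2 + (1 + 0)))) + 10 ≡ 4 * (4 + m)
  total = solve-∀

corollary3p2 : (n : ℕ) → 5 ≤ n → (T : Graph n) → IsTree T → ZC1* (P n) ≤ ZC1* T
corollary3p2 (suc (suc (suc (suc m)))) (s≤s (s≤s (s≤s (s≤s _)))) T tree =
  +-cancelʳ-≤ 10 (ZC1* (P (4 + m))) (ZC1* T)
    (≤-trans (path-upper m) (tree-lower T tree))
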